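{- Let $G=(V,E)$ be a connected, undirected, unweighted graph, $R\subseteq V$ a set of landmarks, $H=(R,\delta_H)$ the highway, and $L$ a highway cover distance labelling over $(G,H)$. For $s,t\in V\setminus R$ let $d^{\top}_{st}=\min\{\delta_L(r_i,s)+\delta_H(r_i,r_j)+\delta_L(r_j,t) : (r_i,\delta_L(r_i,s))\in L(s),\ (r_j,\delta_L(r_j,t))\in L(t)\}$, and let the querying framework return $d_{st}=d_{G[V\setminus R]}(s,t)$ if $d_{G[V\setminus R]}(s,t)\le d^{\top}_{st}$, and $d_{st}=d^{\top}_{st}$ otherwise. Then $d_{st}=d_G(s,t)$ for all $s,t\in V\setminus R$.
   Context: $d_X(u,v)$ denotes the shortest-path distance in a graph $X$ ($\infty$ if no path); $G[V\setminus R]$ is the subgraph induced by $V\setminus R$. A vertex $x$ lies on a shortest path between $u$ and $w$ if $d_G(u,x)+d_G(x,w)=d_G(u,w)$. A highway is a pair $H=(R,\delta_H)$ with $\delta_H(r_1,r_2)=d_G(r_1,r_2)$ for all $r_1,r_2\in R$. A distance labelling assigns to each $v\in V\setminus R$ a label $L(v)$, a set of entries $(r,\delta_L(r,v))$ with $r\in R$ and $\delta_L(r,v)=d_G(r,v)$. It is a highway cover distance labelling over $(G,H)$ if for all $s,t\in V\setminus R$ and every $r\in R$ there exist $(r_i,\delta_L(r_i,s))\in L(s)$ and $(r_j,\delta_L(r_j,t))\in L(t)$ such that $r_i$ lies on a shortest path between $r$ and $s$ and $r_j$ lies on a shortest path between $r$ and $t$ (possibly $r_i=r$ or $r_j=r$).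 -}

module Defs where

open import Data.Nat using (ℕ; zero; suc; _+_; _≤_)
import Data.Nat as ℕ
open import Data.Fin using (Fin)
open import Data.List using (List; foldr; map; concatMap)
open import Data.List.Membership.Propositional using (_∈_)
open import Data.Product using (Σ; ∃; _×_; _,_)
open import Data.Sum using (_⊎_)
open import Relation.Nullary using (¬_)
open import Relation.Binary.PropositionalEquality using (_≡_)

-- Vertices of a graph on n vertices are Fin n; an (undirected, unweighted)
-- graph is given by an edge relation E, required symmetric and loop-free.
Rel : ℕ → Set₁
Rel n = Fin n → Fin n → Set

data Walk {n : ℕ} (E : Rel n) : Fin n → Fin n → ℕ → Set where
  here : ∀ {u} → Walk E u u zero
  step : ∀ {u v w k} → E u v → Walk E v w k → Walk E u w (suc k)

IsUndirectedSimple : {n : ℕ} → Rel n → Set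
IsUndirectedSimple {n} E = (∀ u v → E u v → E v u) × (∀ u → ¬ E u u)

Connected : {n : ℕ} → Rel n → Set
Connected {n} E = ∀ (u v : Fin n) → ∃ λ k → Walk E u v k

Dist : {n : ℕ} → Rel n → Fin n → Fin n → ℕ → Set
Dist E u v d = Walk E u v d × (∀ k → Walk E u v k → d ≤ k)

Induced : {n : ℕ} → Rel n → (Fin n → Set) → Rel n
Induced E R u v = E u v × ¬ R u × ¬ R v

OnShortestPath : {n : ℕ} → Rel n → Fin n → Fin n → Fin n → Set
OnShortestPath E u x w =
  Σ ℕ λ a → Σ ℕ λ b → Dist E u x a × Dist E x w b × Dist E u w (a + b)

data ℕ∞ : Set where
  fin : ℕ → ℕ∞
  ∞   : ℕ∞

min∞ : ℕ∞ → ℕ∞ → ℕ∞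
min∞ (fin a) (fin b) = fin (ℕ._⊓_ a b)
min∞ (fin a) ∞ = fin a
min∞ ∞ y = y

data _≤∞_ : ℕ∞ → ℕ∞ → Set where
  fin≤fin : ∀ {a b} → a ≤ b → fin a ≤∞ fin b
  x≤∞     : ∀ {x} → x ≤∞ ∞

-- A labelling: each vertex carries a list of entries (r , δ_L(r,v)).
Labelling : ℕ → Set
Labelling n = Fin n → List (Fin n × ℕ)

IsHighway : {n : ℕ} → Rel n → (Fin n → Set) → (Fin n → Fin n → ℕ) → Set
IsHighway {n} E R δH = ∀ (r₁ r₂ : Fin n) → R r₁ → R r₂ → Dist E r₁ r₂ (δH r₁ r₂)

IsDistanceLabelling : {n : ℕ} → Rel n → (Fin n → Set) → Labelling n → Set
IsDistanceLabelling {n} E R L =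
  ∀ (v : Fin n) → ¬ R v → ∀ (r : Fin n) (δ : ℕ) → (r , δ) ∈ L v → R r × Dist E r v δ

IsHighwayCover : {n : ℕ} → Rel n → (Fin n → Set) → Labelling n → Set
IsHighwayCover {n} E R L =
  IsDistanceLabelling E R L ×
  (∀ (s t : Fin n) → ¬ R s → ¬ R t → ∀ (r : Fin n) → R r →
     (Σ (Fin n) λ rᵢ → Σ ℕ λ a → (rᵢ , a) ∈ L s × OnShortestPath E r rᵢ s) ×
     (Σ (Fin n) λ rⱼ → Σ ℕ λ b → (rⱼ , b) ∈ L t × OnShortestPath E r rⱼ t))

dTop : {n : ℕ} → Labelling n → (Fin n → Fin n → ℕ) → Fin n → Fin n → ℕ∞
dTop L δH s t =
  foldr min∞ ∞
    (concatMap (λ { (rᵢ , a) → map (λ { (rⱼ , b) → fin (a + δH rᵢ rⱼ + b) }) (L t) }) (L s))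

-- QueryReturns E R L δH s t x : the querying framework returns x for (s,t):
-- x = d_{G[V\R]}(s,t) if d_{G[V\R]}(s,t) ≤ d^⊤_{st}, and x = d^⊤_{st} otherwise
-- (d_{G[V\R]}(s,t) = ∞ when there is no path in G[V\R]).
QueryReturns : {n : ℕ} → Rel n → (Fin n → Set) → Labelling n →
               (Fin n → Fin n → ℕ) → Fin n → Fin n → ℕ∞ → Set
QueryReturns E R L δH s t x =
  (Σ ℕ λ d' → Dist (Induced E R) s t d' × fin d' ≤∞ dTop L δH s t × x ≡ fin d')
  ⊎ (((¬ Σ ℕ λ k → Walk (Induced E R) s t k) ⊎
      (Σ ℕ λ d' → Dist (Induced E R) s t d' × ¬ (fin d' ≤∞ dTop L δH s t)))
     × x ≡ dTop L δH s t)

module Submission where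

-- Every shortest s–t walk either avoids R
-- entirely, so it is a walk in G[V∖R], or it passes through a landmark r.
-- Two bounds on d^⊤_{st} then settle both branches of the query:
--   * lower bound: every candidate δ_L(rᵢ,s) + δ_H(rᵢ,rⱼ) + δ_L(rⱼ,t) is the
--     length of an s–t walk, so d ≤ d^⊤;
--   * upper bound: if some s–t walk of length k passes through a landmark r,
--     the cover property yields labels rᵢ, rⱼ on shortest paths from r to s
--     and t, and the corresponding candidate is at most k, so d^⊤ ≤ k.
-- Because membership in R is not decidable, the case split "avoids R or
-- meets R" only holds under double negation; this suffices since the
-- conclusion x ≡ fin d is an equation in ℕ∞, which is decidable.

open import Defs
open import Data.Nat using (ℕ; suc; _+_; _≤_)
open import Data.Nat.Properties
open import Data.Fin using (Fin)
open import Data.List using (List; []; _∷_; foldr; map; concatMap)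
open import Data.List.Membership.Propositional using (_∈_)
open import Data.List.Membership.Propositional.Properties using (∈-map⁺; ∈-concat⁺′)
open import Data.List.Relation.Unary.All as All using (All; []; _∷_)
open import Data.List.Relation.Unary.All.Properties using (map⁺; concat⁺)
open import Data.List.Relation.Unary.Any using (here; there)
open import Data.Product using (Σ; _×_; _,_; proj₁; proj₂)
open import Data.Sum using (_⊎_; inj₁; inj₂)
open import Relation.Nullary using (¬_; yes; no; contradiction)
open import Relation.Nullary.Decidable using (decidable-stable; ¬¬-excluded-middle)
import Relation.Nullary.Decidable as Dec
open import Relation.Nullary.Negation using (¬¬-map)
open import Relation.Binary.Definitions using (DecidableEquality)
open import Relation.Binary.PropositionalEquality
  using (_≡_; refl; cong; subst)
open import Data.Nat.Tactic.RingSolver using (solve-∀)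

module _ {n : ℕ} {E : Rel n} where

  _++ʷ_ : ∀ {u v w j k} → Walk E u v j → Walk E v w k → Walk E u w (j + k)
  here     ++ʷ q = q
  step e p ++ʷ q = step e (p ++ʷ q)

  reverseʷ : (∀ u v → E u v → E v u) → ∀ {u v k} → Walk E u v k → Walk E v u k
  reverseʷ sym here = here
  reverseʷ sym {k = suc k} (step {u} e p) =
    subst (Walk E _ _) (+-comm k 1) (reverseʷ sym p ++ʷ step (sym u _ e) here)

  shortest : ∀ {u v d k} → Dist E u v d → Walk E u v k → d ≤ k
  shortest (_ , minimal) w = minimal _ w

  dist-unique : ∀ {u v a b} → Dist E u v a → Dist E u v b → a ≡ b
  dist-unique Da Db = ≤-antisym (shortest Da (proj₁ Db)) (shortest Db (proj₁ Da))

  detour-bound : ∀ {r x s a k} → OnShortestPath E r x s → Dist E x s a → Walk E r s k →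
                 Σ ℕ λ c → Dist E r x c × c + a ≤ k
  detour-bound (c , b , Drx , Dxs , Drs) Dxs′ w =
    c , Drx , subst (λ a → c + a ≤ _) (dist-unique Dxs Dxs′) (shortest Drs w)

forget : ∀ {n} {E : Rel n} {R} {u v k} → Walk (Induced E R) u v k → Walk E u v k
forget here             = here
forget (step (e , _) p) = step e (forget p)

data ViaLandmark {n : ℕ} (E : Rel n) (R : Fin n → Set) (u t : Fin n) : ℕ → Set where
  via : ∀ {r k₁ k₂} → R r → Walk E u r k₁ → Walk E r t k₂ → ViaLandmark E R u t (k₁ + k₂)

avoid-or-via : ∀ {n} {E : Rel n} {R} {u t k} → ¬ R u → Walk E u t k →
               ¬ ¬ (Walk (Induced E R) u t k ⊎ ViaLandmark E R u t k)
avoid-or-via ¬Ru here κ = κ (inj₁ here)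
avoid-or-via {R = R} ¬Ru (step {v = v} e w) κ = ¬¬-excluded-middle {A = R v} λ
  { (yes Rv) → κ (inj₂ (via Rv (step e here) w))
  ; (no ¬Rv) → avoid-or-via ¬Rv w λ
      { (inj₁ w′)             → κ (inj₁ (step (e , ¬Ru , ¬Rv) w′))
      ; (inj₂ (via Rr w₁ w₂)) → κ (inj₂ (via Rr (step e w₁) w₂)) } }

-- Equality on ℕ∞ is decidable; this makes the conclusion stable under ¬ ¬.
fin-injective : ∀ {a b} → fin a ≡ fin b → a ≡ b
fin-injective refl = refl

_≟∞_ : DecidableEquality ℕ∞
fin a ≟∞ fin b = Dec.map′ (cong fin) fin-injective (a ≟ b)
fin a ≟∞ ∞     = no λ ()
∞     ≟∞ fin b = no λ ()
∞     ≟∞ ∞     = yes refl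

≤∞-refl : ∀ x → x ≤∞ x
≤∞-refl (fin a) = fin≤fin ≤-refl
≤∞-refl ∞       = x≤∞

≤∞-trans : ∀ {x y z} → x ≤∞ y → y ≤∞ z → x ≤∞ z
≤∞-trans (fin≤fin p) (fin≤fin q) = fin≤fin (≤-trans p q)
≤∞-trans _           x≤∞         = x≤∞

≤∞-antisym : ∀ {a y} → fin a ≤∞ y → y ≤∞ fin a → y ≡ fin a
≤∞-antisym (fin≤fin p) (fin≤fin q) = cong fin (≤-antisym q p)

min∞-≤ˡ : ∀ x y → min∞ x y ≤∞ x
min∞-≤ˡ (fin a) (fin b) = fin≤fin (m⊓n≤m a b)
min∞-≤ˡ (fin a) ∞       = ≤∞-refl (fin a)
min∞-≤ˡ ∞       y       = x≤∞

min∞-≤ʳ : ∀ x y → min∞ x y ≤∞ y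
min∞-≤ʳ (fin a) (fin b) = fin≤fin (m⊓n≤n a b)
min∞-≤ʳ (fin a) ∞       = x≤∞
min∞-≤ʳ ∞       y       = ≤∞-refl y

min∞-glb : ∀ {d} x y → fin d ≤∞ x → fin d ≤∞ y → fin d ≤∞ min∞ x y
min∞-glb (fin a) (fin b) (fin≤fin p) (fin≤fin q) = fin≤fin (⊓-glb p q)
min∞-glb (fin a) ∞       p           _           = p
min∞-glb ∞       y       _           q           = q

minimum-glb : ∀ {d} (xs : List ℕ∞) → All (fin d ≤∞_) xs → fin d ≤∞ foldr min∞ ∞ xs
minimum-glb []       []       = x≤∞
minimum-glb (x ∷ xs) (p ∷ ps) = min∞-glb x _ p (minimum-glb xs ps)

minimum-≤ : ∀ {y} (xs : List ℕ∞) → y ∈ xs → foldr min∞ ∞ xs ≤∞ y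
minimum-≤ (x ∷ xs) (here refl) = min∞-≤ˡ x _
minimum-≤ (x ∷ xs) (there y∈)  = ≤∞-trans (min∞-≤ʳ x _) (minimum-≤ xs y∈)

module _ {n : ℕ} (L : Labelling n) (δH : Fin n → Fin n → ℕ) (s t : Fin n) where

  dTop-≤ : ∀ {rᵢ a rⱼ b} → (rᵢ , a) ∈ L s → (rⱼ , b) ∈ L t →
           dTop L δH s t ≤∞ fin (a + δH rᵢ rⱼ + b)
  dTop-≤ ma mb = minimum-≤ (concatMap _ (L s)) (∈-concat⁺′ (∈-map⁺ _ mb) (∈-map⁺ _ ma))

  dTop-glb : ∀ {d} → (∀ {rᵢ a rⱼ b} → (rᵢ , a) ∈ L s → (rⱼ , b) ∈ L t → d ≤ a + δH rᵢ rⱼ + b) →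
             fin d ≤∞ dTop L δH s t
  dTop-glb bound = minimum-glb (concatMap _ (L s))
    (concat⁺ {xss = map _ (L s)} (map⁺ {xs = L s} (All.tabulate λ {(_ , _)} ma →
      map⁺ {xs = L t} (All.tabulate λ {(_ , _)} mb → fin≤fin (bound ma mb)))))

module HighwayCover {n : ℕ} {E : Rel n} {R : Fin n → Set} {δH : Fin n → Fin n → ℕ} {L : Labelling n}
  (symmetric : ∀ u v → E u v → E v u) (highway : IsHighway E R δH) (cover : IsHighwayCover E R L)
  {s t : Fin n} (¬Rs : ¬ R s) (¬Rt : ¬ R t) where

  private
    label-s : ∀ {r a} → (r , a) ∈ L s → R r × Dist E r s a
    label-s = proj₁ cover s ¬Rs _ _

    label-t : ∀ {r a} → (r , a) ∈ L t → R r × Dist E r t a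
    label-t = proj₁ cover t ¬Rt _ _

  -- d_G(s,t) ≤ d^⊤_{st}: each candidate is the length of the walk
  -- s → rᵢ → rⱼ → t made of shortest paths.
  dist-≤-dTop : ∀ {d} → Dist E s t d → fin d ≤∞ dTop L δH s t
  dist-≤-dTop Dst = dTop-glb L δH s t λ ma mb →
    let (Rᵢ , Dᵢ) = label-s ma
        (Rⱼ , Dⱼ) = label-t mb
    in shortest Dst ((reverseʷ symmetric (proj₁ Dᵢ) ++ʷ proj₁ (highway _ _ Rᵢ Rⱼ)) ++ʷ proj₁ Dⱼ)

  -- d^⊤_{st} ≤ k for every s–t walk of length k through a landmark r:
  -- with rᵢ, rⱼ the cover entries for r, d(r,rᵢ) + δ_L(rᵢ,s) ≤ k₁ and
  -- d(r,rⱼ) + δ_L(rⱼ,t) ≤ k₂, while δ_H(rᵢ,rⱼ) ≤ d(r,rᵢ) + d(r,rⱼ).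
  dTop-≤-via : ∀ {k} → ViaLandmark E R s t k → dTop L δH s t ≤∞ fin k
  dTop-≤-via (via {r} {k₁} {k₂} Rr w₁ w₂)
    with proj₂ cover s t ¬Rs ¬Rt r Rr
  ... | (rᵢ , a , ma , onᵢ) , (rⱼ , b , mb , onⱼ)
    with label-s ma | label-t mb
  ... | Rᵢ , Dᵢ | Rⱼ , Dⱼ
    with detour-bound onᵢ Dᵢ (reverseʷ symmetric w₁) | detour-bound onⱼ Dⱼ w₂
  ... | c , Drᵢ , c+a≤k₁ | c′ , Drⱼ , c′+b≤k₂ =
    ≤∞-trans (dTop-≤ L δH s t ma mb) (fin≤fin (begin
      a + δH rᵢ rⱼ + b    ≤⟨ +-monoˡ-≤ b (+-monoʳ-≤ a highway-bound) ⟩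
      a + (c + c′) + b    ≡⟨ regroup a b c c′ ⟩
      (c + a) + (c′ + b)  ≤⟨ +-mono-≤ c+a≤k₁ c′+b≤k₂ ⟩
      k₁ + k₂             ∎))
    where
    open ≤-Reasoning
    highway-bound : δH rᵢ rⱼ ≤ c + c′
    highway-bound = shortest (highway rᵢ rⱼ Rᵢ Rⱼ) (reverseʷ symmetric (proj₁ Drᵢ) ++ʷ proj₁ Drⱼ)
    regroup : ∀ a b c c′ → a + (c + c′) + b ≡ (c + a) + (c′ + b)
    regroup = solve-∀

  query-correct : ∀ {d x} → Dist E s t d → QueryReturns E R L δH s t x →
                  Walk (Induced E R) s t d ⊎ ViaLandmark E R s t d → x ≡ fin d
  query-correct {d} Dst (inj₁ (d′ , Dind , d′≤dTop , refl)) route =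
    cong fin (≤-antisym (d′≤d route) (shortest Dst (forget (proj₁ Dind))))
    where
    -- The induced distance cannot exceed d: either directly, or via d^⊤ ≤ d.
    d′≤d : Walk (Induced E R) s t d ⊎ ViaLandmark E R s t d → d′ ≤ d
    d′≤d (inj₁ w) = shortest Dind w
    d′≤d (inj₂ v) with ≤∞-trans d′≤dTop (dTop-≤-via v)
    ... | fin≤fin p = p
  query-correct Dst (inj₂ (_ , refl)) (inj₂ v) = ≤∞-antisym (dist-≤-dTop Dst) (dTop-≤-via v)
  query-correct {d} Dst (inj₂ (inj₁ no-walk , refl)) (inj₁ w) = contradiction (d , w) no-walk
  query-correct Dst (inj₂ (inj₂ (d′ , Dind , d′≰dTop) , refl)) (inj₁ w) =
    contradiction (≤∞-trans (fin≤fin (shortest Dind w)) (dist-≤-dTop Dst)) d′≰dTop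

theorem4p6 : (n : ℕ) (E : Rel n) (R : Fin n → Set) (δH : Fin n → Fin n → ℕ) (L : Labelling n) →
    IsUndirectedSimple E → Connected E → IsHighway E R δH → IsHighwayCover E R L →
    ∀ (s t : Fin n) → ¬ R s → ¬ R t →
    ∀ (d : ℕ) (x : ℕ∞) → Dist E s t d → QueryReturns E R L δH s t x → x ≡ fin d
theorem4p6 n E R δH L (symmetric , _) _ highway cover s t ¬Rs ¬Rt d x Dst query =
  decidable-stable (x ≟∞ fin d)
    (¬¬-map (query-correct Dst query) (avoid-or-via ¬Rs (proj₁ Dst)))
  where open HighwayCover symmetric highway cover ¬Rs ¬Rt
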